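{- Let $\varphi(x;z)$ and $\tilde\varphi(x;z)$ be stably separated formulas and let $\mathcal{D},\tilde{\mathcal{D}}\subseteq\mathcal{U}^{|z|}$ be finitely separated by $\varphi,\tilde\varphi$. Then for some $m,n<\omega$ the sets $\mathcal{D},\tilde{\mathcal{D}}$ are honestly finitely separated by $\psi,\tilde\psi$, where $\psi(\langle x_{i,j}\rangle_{i\le m,j\le n};z)=\bigwedge_{i=0}^m\bigvee_{j=0}^n\varphi(x_{i,j};z)$ and $\tilde\psi(\langle x_{i,j}\rangle_{i\le m,j\le n};z)=\bigvee_{i=0}^m\bigwedge_{j=0}^n\tilde\varphi(x_{i,j};z)$.
   Context: $\mathcal{U}$ is a structure for a first-order language $\mathcal{L}$ (in the paper, the monster model of the positive setting; no saturation is used), and $\varphi(x;z),\tilde\varphi(x;z)$ are arbitrary $\mathcal{L}$-formulas, $x,z$ finite tuples of variables. For a formula $\chi(x;z)$ and $a\in\mathcal{U}^{|x|}$, $\chi(a;\mathcal{U})=\{b\in\mathcal{U}^{|z|}:\mathcal{U}\models\chi(a;b)\}$. $\varphi,\tilde\varphi$ are stably separated if for some $n<\omega$ there is no sequence $\langle a_i;b_i:i<n\rangle$ with $\mathcal{U}\models\varphi(a_i;b_j)\wedge\tilde\varphi(a_j;b_i)$ for all $i<j<n$. Sets $\mathcal{D},\tilde{\mathcal{D}}\subseteq\mathcal{U}^{|z|}$ are finitely separated by $\varphi,\tilde\varphi$ if for every finite $B\subseteq\mathcal{U}^{|z|}$ there is $a\in\mathcal{U}^{|x|}$ with (ii) $B\cap\mathcal{D}\subseteq\varphi(a;\mathcal{U})$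 and (iii) $B\cap\tilde{\mathcal{D}}\subseteq\tilde\varphi(a;\mathcal{U})$. They are honestly finitely separated if $a$ can moreover be chosen so that (iv) $\mathcal{D}\cap\tilde\varphi(a;\mathcal{U})=\emptyset$ and (v) $\tilde{\mathcal{D}}\cap\varphi(a;\mathcal{U})=\emptyset$. These notions apply to any pair of formulas in place of $\varphi,\tilde\varphi$ (with the tuple of variables $x$ replaced accordingly). -}

module Defs where

open import Data.Nat using (ℕ; suc; _<_)
open import Data.Fin using (Fin; toℕ)
open import Data.Vec using (Vec)
open import Data.List using (List)
open import Data.List.Membership.Propositional using (_∈_)
open import Data.Product using (Σ; ∃; _×_; _,_)
open import Data.Empty using (⊥)
open import Relation.Nullary using (¬_)

-- A "formula" χ(x;z) with parameter-side type A (tuples for x) and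
-- object side Z (tuples for z) is represented by its interpretation in 𝒰:
-- a relation A → Z → Set.  χ(a;𝒰) is the predicate χ a.

StablySeparated : {A Z : Set} → (A → Z → Set) → (A → Z → Set) → Set
StablySeparated {A} {Z} φ φ̃ =
  Σ ℕ λ n → ¬ (Σ (Fin n → A) λ a → Σ (Fin n → Z) λ b →
     (i j : Fin n) → toℕ i < toℕ j → φ (a i) (b j) × φ̃ (a j) (b i))

Separates : {A Z : Set} → (A → Z → Set) → (A → Z → Set) →
            (Z → Set) → (Z → Set) → List Z → A → Set
Separates {Z = Z} χ χ̃ D D̃ B a =
  ((b : Z) → b ∈ B → D b → χ a b) × ((b : Z) → b ∈ B → D̃ b → χ̃ a b)

Honest : {A Z : Set} → (A → Z → Set) → (A → Z → Set) →
         (Z → Set) → (Z → Set) → A → Set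
Honest {Z = Z} χ χ̃ D D̃ a =
  ((b : Z) → D b → χ̃ a b → ⊥) × ((b : Z) → D̃ b → χ a b → ⊥)

FinitelySeparated : {A Z : Set} → (A → Z → Set) → (A → Z → Set) →
                    (Z → Set) → (Z → Set) → Set
FinitelySeparated {A} {Z} χ χ̃ D D̃ = (B : List Z) → Σ A λ a → Separates χ χ̃ D D̃ B a

HonestlyFinitelySeparated : {A Z : Set} → (A → Z → Set) → (A → Z → Set) →
                            (Z → Set) → (Z → Set) → Set
HonestlyFinitelySeparated {A} {Z} χ χ̃ D D̃ =
  (B : List Z) → Σ A λ a → Separates χ χ̃ D D̃ B a × Honest χ χ̃ D D̃ a

Ψ : {A Z : Set} (m n : ℕ) → (A → Z → Set) → (Fin (suc m) → Fin (suc n) → A) → Z → Set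
Ψ m n φ a b = (i : Fin (suc m)) → Σ (Fin (suc n)) λ j → φ (a i j) b

Ψ̃ : {A Z : Set} (m n : ℕ) → (A → Z → Set) → (Fin (suc m) → Fin (suc n) → A) → Z → Set
Ψ̃ m n φ̃ a b = Σ (Fin (suc m)) λ i → (j : Fin (suc n)) → φ̃ (a i j) b

-- Stability bounds the length of every ladder, and ladders are what a failed attempt at
-- honesty produces.  Separate B together with finitely many earlier witnesses by some a₀; if a
-- point d ∈ 𝒟 still satisfies φ̃(a₀; d) (and φ̃ at all earlier entries), then (a₀, d) extends a
-- (φ, φ̃)-ladder, so after at most N steps the entries found form a row whose conjunction of φ̃
-- misses 𝒟.  Dually, if a point of 𝒟̃ still satisfies the disjunction of φ over a new row, it
-- satisfies φ at some entry k, and (row k, point) extends a (φ̃, φ)-ladder; branching over k,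
-- after at most N levels every point of 𝒟̃ fails the disjunction over some row.  Excluded middle
-- decides at each step whether the extension is possible.
module Submission where

open import Defs
open import Axiom.ExcludedMiddle using (ExcludedMiddle)
open import Level using (0ℓ)
open import Data.Nat using (ℕ; zero; suc; _+_; _*_; _<_; s≤s)
open import Data.Nat.Properties using (+-suc; +-identityʳ; ∸-monoʳ-<)
open import Data.Fin using (Fin; toℕ; opposite; remQuot; combine) renaming (zero to fzero; suc to fsuc)
open import Data.Fin.Properties using (opposite-prop; remQuot-combine; toℕ<n)
open import Data.Vec using (Vec)
open import Data.Vec.Functional using (_∷_)
open import Data.List using (List; _++_; tabulate)
open import Data.List.Membership.Propositional using (_∈_)
open import Data.List.Membership.Propositional.Properties using (∈-tabulate⁺; ∈-++⁺ˡ; ∈-++⁺ʳ)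
open import Data.Product using (Σ; _×_; _,_; proj₁; proj₂; uncurry)
open import Data.Empty using (⊥-elim)
open import Relation.Nullary using (¬_; yes; no)
open import Relation.Binary.PropositionalEquality using (_≡_; refl; trans; subst; sym; cong)

Ladder : {A Z : Set} → (A → Z → Set) → (A → Z → Set) → (n : ℕ) → (Fin n → A) → (Fin n → Z) → Set
Ladder R S n a b = (i j : Fin n) → toℕ i < toℕ j → R (a i) (b j) × S (a j) (b i)

HasLadder : {A Z : Set} → (A → Z → Set) → (A → Z → Set) → ℕ → Set
HasLadder {A} {Z} R S n = Σ (Fin n → A) λ a → Σ (Fin n → Z) λ b → Ladder R S n a b

all-∷ : {X : Set} {n : ℕ} (P : X → Set) {x : X} {f : Fin n → X} →
        P x → (∀ i → P (f i)) → ∀ i → P ((x ∷ f) i)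
all-∷ P px pf fzero    = px
all-∷ P px pf (fsuc i) = pf i

ladder-∷ : {A Z : Set} {R S : A → Z → Set} {n : ℕ} {a : Fin n → A} {b : Fin n → Z} →
           Ladder R S n a b → (a₀ : A) (b₀ : Z) → (∀ j → R a₀ (b j)) → (∀ j → S (a j) b₀) →
           Ladder R S (suc n) (a₀ ∷ a) (b₀ ∷ b)
ladder-∷ L a₀ b₀ R₀ S₀ fzero    fzero    ()
ladder-∷ L a₀ b₀ R₀ S₀ fzero    (fsuc j) _       = R₀ j , S₀ j
ladder-∷ L a₀ b₀ R₀ S₀ (fsuc i) fzero    ()
ladder-∷ L a₀ b₀ R₀ S₀ (fsuc i) (fsuc j) (s≤s p) = L i j p

opposite-< : {n : ℕ} (i j : Fin n) → toℕ i < toℕ j → toℕ (opposite j) < toℕ (opposite i)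
opposite-< i j p rewrite opposite-prop i | opposite-prop j = ∸-monoʳ-< (s≤s p) (toℕ<n j)

HasLadder-swap : {A Z : Set} {R S : A → Z → Set} {n : ℕ} → HasLadder S R n → HasLadder R S n
HasLadder-swap {R = R} {S} {n} (a , b , L) =
  (λ i → a (opposite i)) , (λ i → b (opposite i)) , reversed
  where
  reversed : Ladder R S n (λ i → a (opposite i)) (λ i → b (opposite i))
  reversed i j p = let (Sab , Rab) = L (opposite j) (opposite i) (opposite-< i j p) in Rab , Sab

flatten : {X : Set} {m n : ℕ} → (Fin m → Fin n → X) → Fin (m * n) → X
flatten {n = n} F i = uncurry F (remQuot n i)

flatten-combine : {X : Set} {m n : ℕ} (F : Fin m → Fin n → X) (i : Fin m) (j : Fin n) →
                  flatten F (combine i j) ≡ F i j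
flatten-combine F i j = cong (uncurry F) (remQuot-combine i j)

flatten-all : {X : Set} {m n : ℕ} (P : X → Set) {F : Fin m → Fin n → X} →
              (∀ i j → P (F i j)) → ∀ k → P (flatten F k)
flatten-all P PF k = PF _ _

coverSize : ℕ → ℕ → ℕ
coverSize w zero    = zero
coverSize w (suc d) = suc w * suc (coverSize w d)

module Cover (em : ExcludedMiddle 0ℓ) {A Z : Set} (R S : A → Z → Set) (N : ℕ)
  (noLadder : ¬ HasLadder R S N) (P : Z → Set) {w : ℕ} (Good : (Fin (suc w) → A) → Set)
  (block : (X : List Z) → Σ (Fin (suc w) → A) λ β → Good β × (∀ k z → z ∈ X → P z → R (β k) z))
  where

  Block : Set
  Block = Fin (suc w) → A

  Avoids : Block → Z → Set
  Avoids β z = ∀ k → ¬ S (β k) z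

  Family : ℕ → Set
  Family d = Fin (suc (coverSize w d)) → Block

  CoversAbove : {s : ℕ} → (Fin s → A) → {d : ℕ} → Family d → Set
  CoversAbove a {d} M =
    ∀ z → P z → (∀ t → S (a t) z) → Σ (Fin (suc (coverSize w d))) λ r → Avoids (M r) z

  -- A point z ∈ P not yet avoided by the first block β lies S-above β k for some k;
  -- if such points exist, one of them extends the ladder by the rung (β k , z).
  cover : (d s : ℕ) → d + s ≡ N → (a : Fin s → A) (b : Fin s → Z) →
          Ladder R S s a b → (∀ t → P (b t)) →
          Σ (Family d) λ M → (∀ r → Good (M r)) × CoversAbove a {d} M
  cover zero    s refl a b L Pb = ⊥-elim (noLadder (a , b , L))
  cover (suc d) s eq   a b L Pb = M , good , covers
    where
    β : Block
    β = proj₁ (block (tabulate b))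

    goodβ : Good β
    goodβ = proj₁ (proj₂ (block (tabulate b)))

    Rβ : ∀ k j → R (β k) (b j)
    Rβ k j = proj₂ (proj₂ (block (tabulate b))) k (b j) (∈-tabulate⁺ j) (Pb j)

    branch : (k : Fin (suc w)) →
             Σ (Family d) λ F → (∀ r → Good (F r)) × CoversAbove (β k ∷ a) {d} F
    branch k with em {Σ Z λ z → P z × (∀ t → S (a t) z) × S (β k) z}
    ... | no ∄z = (λ _ → β) , (λ _ → goodβ) ,
                  λ z Pz Sz → ⊥-elim (∄z (z , Pz , (λ t → Sz (fsuc t)) , Sz fzero))
    ... | yes (z , Pz , Saz , Sβz) =
          cover d (suc s) (trans (+-suc d s) eq) (β k ∷ a) (z ∷ b)
                (ladder-∷ {R = R} {S} L (β k) z (Rβ k) Saz) (all-∷ P Pz Pb)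

    M : Family (suc d)
    M fzero    = β
    M (fsuc i) = flatten (λ k → proj₁ (branch k)) i

    good : ∀ r → Good (M r)
    good fzero    = goodβ
    good (fsuc i) = flatten-all Good (λ k → proj₁ (proj₂ (branch k))) i

    covers : CoversAbove a {suc d} M
    covers z Pz Saz with em {Σ (Fin (suc w)) λ k → S (β k) z}
    ... | no ∄k = fzero , λ k Sβz → ∄k (k , Sβz)
    ... | yes (k , Sβz) with proj₂ (proj₂ (branch k)) z Pz (all-∷ (λ x → S x z) Sβz Saz)
    ... | j , avoids = fsuc (combine k j) ,
          subst (λ γ → Avoids γ z) (sym (flatten-combine (λ k → proj₁ (branch k)) k j)) avoids

  coverAll : Σ (Family N) λ M → (∀ r → Good (M r)) ×
             (∀ z → P z → Σ (Fin (suc (coverSize w N))) λ r → Avoids (M r) z)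
  coverAll = let (M , good , covers) = cover N zero (+-identityʳ N) (λ ()) (λ ()) (λ ()) (λ ())
             in M , good , λ z Pz → covers z Pz (λ ())

Separates-++ˡ : {A Z : Set} {χ χ̃ : A → Z → Set} {D D̃ : Z → Set} (C X : List Z) {a : A} →
                Separates χ χ̃ D D̃ (C ++ X) a → Separates χ χ̃ D D̃ C a
Separates-++ˡ C X (onD , onD̃) =
  (λ z z∈C → onD z (∈-++⁺ˡ z∈C)) , (λ z z∈C → onD̃ z (∈-++⁺ˡ z∈C))

module HonestSeparation (em : ExcludedMiddle 0ℓ) {A Z : Set} {φ φ̃ : A → Z → Set} {D D̃ : Z → Set}
  (N : ℕ) (noLadder : ¬ HasLadder φ φ̃ N) (fs : FinitelySeparated φ φ̃ D D̃) where

  rowLength : ℕ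
  rowLength = coverSize 0 N

  Row : Set
  Row = Fin (suc rowLength) → A

  Sep : List Z → A → Set
  Sep = Separates φ φ̃ D D̃

  GoodRow : List Z → Row → Set
  GoodRow C row = (∀ k → Sep C (row k)) ×
                  (∀ z → D z → Σ (Fin (suc rowLength)) λ k → ¬ φ̃ (row k) z)

  entryAbove : (C X : List Z) →
               Σ (Fin 1 → A) λ β → Sep C (β fzero) × (∀ k z → z ∈ X → D z → φ (β k) z)
  entryAbove C X = let (a , sep) = fs (C ++ X)
                   in (λ _ → a) , Separates-++ˡ {χ = φ} {φ̃} C X sep ,
                      λ _ z z∈X Dz → proj₁ sep z (∈-++⁺ʳ C z∈X) Dz

  module RowCover (C : List Z) = Cover em φ φ̃ N noLadder D (λ β → Sep C (β fzero)) (entryAbove C)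

  goodRow : (C : List Z) → Σ Row (GoodRow C)
  goodRow C with RowCover.coverAll C
  ... | M , good , covers =
    (λ k → M k fzero) , good , λ z Dz → let (k , avoids) = covers z Dz in k , avoids fzero

  matrixHeight : ℕ
  matrixHeight = coverSize rowLength N

  goodRowAbove : (B X : List Z) →
                 Σ Row λ row → GoodRow B row × (∀ k z → z ∈ X → D̃ z → φ̃ (row k) z)
  goodRowAbove B X = let (row , sep , honest) = goodRow (B ++ X)
                     in row , ((λ k → Separates-++ˡ {χ = φ} {φ̃} B X (sep k)) , honest) ,
                        λ k z z∈X D̃z → proj₂ (sep k) z (∈-++⁺ʳ B z∈X) D̃z

  module MatrixCover (B : List Z) =
    Cover em φ̃ φ N (λ ladder → noLadder (HasLadder-swap {R = φ} {φ̃} ladder))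
          D̃ (GoodRow B) (goodRowAbove B)

  honestlySeparated :
    HonestlyFinitelySeparated (Ψ matrixHeight rowLength φ) (Ψ̃ matrixHeight rowLength φ̃) D D̃
  honestlySeparated B with MatrixCover.coverAll B
  ... | M , good , covers = M , (ψ-on-D , ψ̃-on-D̃) , (ψ̃-misses-D , ψ-misses-D̃)
    where
    ψ-on-D : ∀ z → z ∈ B → D z → Ψ matrixHeight rowLength φ M z
    ψ-on-D z z∈B Dz r = fzero , proj₁ (proj₁ (good r) fzero) z z∈B Dz

    ψ̃-on-D̃ : ∀ z → z ∈ B → D̃ z → Ψ̃ matrixHeight rowLength φ̃ M z
    ψ̃-on-D̃ z z∈B D̃z = fzero , λ k → proj₂ (proj₁ (good fzero) k) z z∈B D̃z

    ψ̃-misses-D : ∀ z → D z → ¬ Ψ̃ matrixHeight rowLength φ̃ M z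
    ψ̃-misses-D z Dz (r , φ̃-row) = let (k , ¬φ̃) = proj₂ (good r) z Dz in ¬φ̃ (φ̃-row k)

    ψ-misses-D̃ : ∀ z → D̃ z → ¬ Ψ matrixHeight rowLength φ M z
    ψ-misses-D̃ z D̃z ψ = let (r , avoids) = covers z D̃z ; (k , φ-entry) = ψ r in avoids k φ-entry

theorem11p3 : ExcludedMiddle 0ℓ →
    (U : Set) (kx kz : ℕ) →
    (φ φ̃ : Vec U kx → Vec U kz → Set) →
    (D D̃ : Vec U kz → Set) →
    StablySeparated φ φ̃ →
    FinitelySeparated φ φ̃ D D̃ →
    Σ ℕ λ m → Σ ℕ λ n →
    HonestlyFinitelySeparated (Ψ m n φ) (Ψ̃ m n φ̃) D D̃
theorem11p3 em U kx kz φ φ̃ D D̃ (N , noLadder) fs = matrixHeight , rowLength , honestlySeparated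
  where open HonestSeparation em N noLadder fs
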